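{- Let $n,q\ge 1$ and $c\ge 0$ be integers. If there exists a family $PComS(n,q,-c)$, then there exists a partial Hadamard matrix $PH(n\times(nq+c))$, i.e. an $n\times(nq+c)$ matrix $H$ with all entries in $\{+1,-1\}$ satisfying $HH^{t}=(nq+c)I_n$.
   Context: The periodic autocorrelation of $X=(x_0,\dots,x_{n-1})\in\{\pm1\}^n$ at shift $k$ is $\mathsf{P}_X(k)=\sum_{i=0}^{n-1}x_ix_{(i+k)\bmod n}$. A family (list, repetitions allowed) $A_1,\dots,A_q\in\{\pm1\}^n$ is a $PComS(n,q,c)$ if $\sum_{i=1}^q\mathsf{P}_{A_i}(k)=c$ for all $1\le k\le n-1$. A partial Hadamard matrix $PH(k\times m)$ is a $k\times m$ matrix with entries $\pm1$ such that $PH\cdot PH^{t}=mI_k$. -}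

module Defs where

open import Data.Nat as ℕ using (ℕ; zero; suc; NonZero)
open import Data.Nat.DivMod using (_mod_)
open import Data.Fin using (Fin; toℕ; zero; suc)
open import Data.Integer using (ℤ; +_; -[1+_]; _+_; _*_; -_)
open import Data.Sum using (_⊎_)
open import Data.Product using (_×_)
open import Relation.Binary.PropositionalEquality using (_≡_)
open import Relation.Nullary using (¬_)

sumFin : (n : ℕ) → (Fin n → ℤ) → ℤ
sumFin zero    f = + 0
sumFin (suc n) f = f zero + sumFin n (λ i → f (suc i))

IsPM1 : ℤ → Set
IsPM1 x = (x ≡ + 1) ⊎ (x ≡ - + 1)

IsBinarySeq : (n : ℕ) → (Fin n → ℤ) → Set
IsBinarySeq n X = ∀ i → IsPM1 (X i)

shiftIdx : (n : ℕ) → .{{_ : NonZero n}} → Fin n → ℕ → Fin n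
shiftIdx n i k = (toℕ i ℕ.+ k) mod n

PAF : (n : ℕ) → .{{_ : NonZero n}} → (Fin n → ℤ) → ℕ → ℤ
PAF n X k = sumFin n (λ i → X i * X (shiftIdx n i k))

-- PComS(n,q,c): a family A_1..A_q (repetitions allowed) of ±1 sequences
-- of length n with Σ_j P_{A_j}(k) = c for all 1 ≤ k ≤ n-1
IsPComS : (n q : ℕ) → .{{_ : NonZero n}} → ℤ → (Fin q → Fin n → ℤ) → Set
IsPComS n q c A =
  (∀ j → IsBinarySeq n (A j)) ×
  (∀ (k : ℕ) → 1 ℕ.≤ k → k ℕ.< n → sumFin q (λ j → PAF n (A j) k) ≡ c)

δ : {n : ℕ} → Fin n → Fin n → ℤ
δ zero    zero    = + 1
δ zero    (suc _) = + 0
δ (suc _) zero    = + 0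
δ (suc i) (suc j) = δ i j

IsPartialHadamard : (k m : ℕ) → (Fin k → Fin m → ℤ) → Set
IsPartialHadamard k m H =
  (∀ i j → IsPM1 (H i j)) ×
  (∀ i i' → sumFin m (λ j → H i j * H i' j) ≡ (+ m) * δ i i')

module Submission where

-- Let A_1, …, A_q be a PComS(n,q,-c).  For a sequence a of length n let
-- C(a) be its circulant matrix, C(a)_{i,l} = a_{(l+i) mod n}, and consider
--     H = [ C(A_1) | … | C(A_q) | J ]          (J the n × c all-ones matrix),
-- an n × (qn + c) matrix with ±1 entries.  Every row of H has squared norm
-- equal to its length.  The inner product of rows i < i' splits over the
-- column blocks; putting d = i' - i (so 1 ≤ d < n), the block C(a) contributes
-- Σ_l a_{l+i} a_{l+i+d}, which equals the periodic autocorrelation P_a(d)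
-- because sums over ℤ/n are invariant under rotation.  So the inner product is
-- Σ_t P_{A_t}(d) + c = -c + c = 0, and H is a PH(n × (nq + c)).

open import Defs
open import Data.Nat using (ℕ; _+_; _*_; _≤_; NonZero)
open import Data.Fin using (Fin)
open import Data.Integer using (ℤ; -_; +_)
open import Data.Product using (Σ-syntax; ∃-syntax)

open import Data.Nat using (zero; suc; _<_; _∸_)
open import Data.Nat.Properties
  using (+-identityʳ; +-assoc; +-comm; *-comm; <-cmp; m∸n≤m; ≤-<-trans; <⇒≤; m+[n∸m]≡n; m<n⇒0<n∸m)
open import Data.Nat.DivMod using (_mod_; _%_; m%n<n; m<n⇒m%n≡m; n%n≡0; m%n%n≡m%n; %-distribˡ-+; %-congˡ)
open import Data.Fin using (zero; suc; toℕ; splitAt; inject₁; fromℕ)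
open import Data.Fin.Properties using (toℕ-injective; toℕ-fromℕ<; toℕ<n; toℕ-inject₁; toℕ-fromℕ)
import Data.Integer as ℤ
import Data.Integer.Properties as ℤₚ
open import Data.Vec.Functional using (_++_)
open import Data.Sum using (inj₁; inj₂)
open import Data.Product using (_,_)
open import Function using (_∘_)
open import Relation.Binary using (tri<; tri≈; tri>)
open import Relation.Binary.PropositionalEquality
  using (_≡_; _≢_; refl; sym; trans; cong; cong₂; subst; module ≡-Reasoning)
open ≡-Reasoning

sumFin-cong : ∀ m {f g : Fin m → ℤ} → (∀ j → f j ≡ g j) → sumFin m f ≡ sumFin m g
sumFin-cong zero    eq = refl
sumFin-cong (suc m) eq = cong₂ ℤ._+_ (eq zero) (sumFin-cong m (eq ∘ suc))

sumFin-last : ∀ m (f : Fin (suc m) → ℤ) →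
  sumFin (suc m) f ≡ sumFin m (f ∘ inject₁) ℤ.+ f (fromℕ m)
sumFin-last zero    f = trans (ℤₚ.+-identityʳ (f zero)) (sym (ℤₚ.+-identityˡ (f zero)))
sumFin-last (suc m) f = begin
  f zero ℤ.+ sumFin (suc m) (f ∘ suc)
    ≡⟨ cong (λ x → f zero ℤ.+ x) (sumFin-last m (f ∘ suc)) ⟩
  f zero ℤ.+ (sumFin m (f ∘ suc ∘ inject₁) ℤ.+ f (fromℕ (suc m)))
    ≡⟨ sym (ℤₚ.+-assoc (f zero) _ _) ⟩
  sumFin (suc m) (f ∘ inject₁) ℤ.+ f (fromℕ (suc m)) ∎

++-suc : ∀ {A : Set} m {k} (u : Fin (suc m) → A) (v : Fin k → A) j →
  (u ++ v) (suc j) ≡ ((u ∘ suc) ++ v) j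
++-suc m u v j with splitAt m j
... | inj₁ _ = refl
... | inj₂ _ = refl

sumFin-++ : ∀ m {k} (u : Fin m → ℤ) (v : Fin k → ℤ) →
  sumFin (m + k) (u ++ v) ≡ sumFin m u ℤ.+ sumFin k v
sumFin-++ zero    u v = sym (ℤₚ.+-identityˡ _)
sumFin-++ (suc m) u v = begin
  u zero ℤ.+ sumFin (m + _) ((u ++ v) ∘ suc)
    ≡⟨ cong (λ x → u zero ℤ.+ x) (sumFin-cong (m + _) (++-suc m u v)) ⟩
  u zero ℤ.+ sumFin (m + _) ((u ∘ suc) ++ v)
    ≡⟨ cong (λ x → u zero ℤ.+ x) (sumFin-++ m (u ∘ suc) v) ⟩
  u zero ℤ.+ (sumFin m (u ∘ suc) ℤ.+ sumFin _ v)
    ≡⟨ sym (ℤₚ.+-assoc (u zero) _ _) ⟩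
  sumFin (suc m) u ℤ.+ sumFin _ v ∎

-- The standard inner product; the Gram condition of IsPartialHadamard is
-- stated with exactly this sum.
_·_ : ∀ {m} → (Fin m → ℤ) → (Fin m → ℤ) → ℤ
_·_ {m} u v = sumFin m (λ j → u j ℤ.* v j)

infix 7 _·_

·-comm : ∀ {m} (u v : Fin m → ℤ) → u · v ≡ v · u
·-comm {m} u v = sumFin-cong m (λ j → ℤₚ.*-comm (u j) (v j))

·-++ : ∀ {m k} (u v : Fin m → ℤ) (u′ v′ : Fin k → ℤ) →
  (u ++ u′) · (v ++ v′) ≡ u · v ℤ.+ u′ · v′
·-++ {m} {k} u v u′ v′ = trans (sumFin-cong (m + k) pointwise) (sumFin-++ m _ _)
  where
  pointwise : ∀ j → (u ++ u′) j ℤ.* (v ++ v′) j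
                  ≡ ((λ i → u i ℤ.* v i) ++ (λ i → u′ i ℤ.* v′ i)) j
  pointwise j with splitAt m j
  ... | inj₁ _ = refl
  ... | inj₂ _ = refl

blocks : ∀ {A : Set} {n} q → (Fin q → Fin n → A) → Fin (q * n) → A
blocks zero    B ()
blocks (suc q) B = B zero ++ blocks q (B ∘ suc)

·-blocks : ∀ {n} q (B B′ : Fin q → Fin n → ℤ) →
  blocks q B · blocks q B′ ≡ sumFin q (λ t → B t · B′ t)
·-blocks zero    B B′ = refl
·-blocks (suc q) B B′ =
  trans (·-++ (B zero) (B′ zero) _ _) (cong (λ x → B zero · B′ zero ℤ.+ x) (·-blocks q (B ∘ suc) (B′ ∘ suc)))

++-all : ∀ {A : Set} (P : A → Set) {m k} {u : Fin m → A} {v : Fin k → A} →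
  (∀ j → P (u j)) → (∀ j → P (v j)) → ∀ j → P ((u ++ v) j)
++-all P {m} pu pv j with splitAt m j
... | inj₁ i = pu i
... | inj₂ i = pv i

blocks-all : ∀ {A : Set} (P : A → Set) {n} q {B : Fin q → Fin n → A} →
  (∀ t l → P (B t l)) → ∀ j → P (blocks q B j)
blocks-all P zero    pB ()
blocks-all P (suc q) pB = ++-all P (pB zero) (blocks-all P q (pB ∘ suc))

·-self-pm : ∀ {m} (u : Fin m → ℤ) → (∀ j → IsPM1 (u j)) → u · u ≡ + m
·-self-pm {zero}  u pm = refl
·-self-pm {suc m} u pm =
  cong₂ ℤ._+_ (square (pm zero)) (·-self-pm (u ∘ suc) (pm ∘ suc))
  where
  square : ∀ {x} → IsPM1 x → x ℤ.* x ≡ + 1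
  square (inj₁ refl) = refl
  square (inj₂ refl) = refl

module _ {n : ℕ} .{{_ : NonZero n}} where

  toℕ-mod : ∀ a → toℕ (a mod n) ≡ a % n
  toℕ-mod a = toℕ-fromℕ< (m%n<n a n)

  shiftIdx-+ : ∀ (l : Fin n) j d → shiftIdx n (shiftIdx n l j) d ≡ shiftIdx n l (j + d)
  shiftIdx-+ l j d = toℕ-injective (begin
    toℕ ((toℕ ((toℕ l + j) mod n) + d) mod n)
      ≡⟨ toℕ-mod _ ⟩
    (toℕ ((toℕ l + j) mod n) + d) % n
      ≡⟨ %-congˡ (cong (_+ d) (toℕ-mod (toℕ l + j))) ⟩
    ((toℕ l + j) % n + d) % n
      ≡⟨ %-distribˡ-+ ((toℕ l + j) % n) d n ⟩
    ((toℕ l + j) % n % n + d % n) % n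
      ≡⟨ %-congˡ (cong (_+ d % n) (m%n%n≡m%n (toℕ l + j) n)) ⟩
    ((toℕ l + j) % n + d % n) % n
      ≡⟨ sym (%-distribˡ-+ (toℕ l + j) d n) ⟩
    (toℕ l + j + d) % n
      ≡⟨ %-congˡ (+-assoc (toℕ l) j d) ⟩
    (toℕ l + (j + d)) % n
      ≡⟨ sym (toℕ-mod _) ⟩
    toℕ ((toℕ l + (j + d)) mod n) ∎)

mod-toℕ : ∀ {n} a (j : Fin (suc n)) → a ≡ toℕ j → a mod suc n ≡ j
mod-toℕ a j refl = toℕ-injective (trans (toℕ-mod (toℕ j)) (m<n⇒m%n≡m (toℕ<n j)))

shiftIdx-zero : ∀ {n} (l : Fin (suc n)) → shiftIdx (suc n) l 0 ≡ l
shiftIdx-zero l = mod-toℕ _ l (+-identityʳ (toℕ l))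

shiftIdx-inject₁ : ∀ {n} (i : Fin n) → shiftIdx (suc n) (inject₁ i) 1 ≡ suc i
shiftIdx-inject₁ i = mod-toℕ _ (suc i) (trans (cong (_+ 1) (toℕ-inject₁ i)) (+-comm (toℕ i) 1))

shiftIdx-fromℕ : ∀ n → shiftIdx (suc n) (fromℕ n) 1 ≡ zero
shiftIdx-fromℕ n = toℕ-injective (begin
  toℕ ((toℕ (fromℕ n) + 1) mod suc n) ≡⟨ toℕ-mod (toℕ (fromℕ n) + 1) ⟩
  (toℕ (fromℕ n) + 1) % suc n         ≡⟨ %-congˡ (trans (cong (_+ 1) (toℕ-fromℕ n)) (+-comm n 1)) ⟩
  suc n % suc n                       ≡⟨ n%n≡0 (suc n) ⟩
  0 ∎)

sumFin-rotate₁ : ∀ {n} (g : Fin (suc n) → ℤ) →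
  sumFin (suc n) (λ l → g (shiftIdx (suc n) l 1)) ≡ sumFin (suc n) g
sumFin-rotate₁ {n} g = begin
  sumFin (suc n) (λ l → g (shiftIdx (suc n) l 1))
    ≡⟨ sumFin-last n (λ l → g (shiftIdx (suc n) l 1)) ⟩
  sumFin n (λ i → g (shiftIdx (suc n) (inject₁ i) 1)) ℤ.+ g (shiftIdx (suc n) (fromℕ n) 1)
    ≡⟨ cong₂ ℤ._+_ (sumFin-cong n (cong g ∘ shiftIdx-inject₁)) (cong g (shiftIdx-fromℕ n)) ⟩
  sumFin n (g ∘ suc) ℤ.+ g zero
    ≡⟨ ℤₚ.+-comm _ (g zero) ⟩
  sumFin (suc n) g ∎

sumFin-rotate : ∀ {n} k (g : Fin (suc n) → ℤ) →
  sumFin (suc n) (λ l → g (shiftIdx (suc n) l k)) ≡ sumFin (suc n) g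
sumFin-rotate {n} zero    g = sumFin-cong (suc n) (cong g ∘ shiftIdx-zero)
sumFin-rotate {n} (suc k) g = begin
  sumFin (suc n) (λ l → g (shiftIdx (suc n) l (1 + k)))
    ≡⟨ sumFin-cong (suc n) (λ l → cong g (sym (shiftIdx-+ l 1 k))) ⟩
  sumFin (suc n) (λ l → g (shiftIdx (suc n) (shiftIdx (suc n) l 1) k))
    ≡⟨ sumFin-rotate₁ (λ m → g (shiftIdx (suc n) m k)) ⟩
  sumFin (suc n) (λ m → g (shiftIdx (suc n) m k))
    ≡⟨ sumFin-rotate k g ⟩
  sumFin (suc n) g ∎

circulant : ∀ {n} .{{_ : NonZero n}} → (Fin n → ℤ) → Fin n → Fin n → ℤ
circulant {n} a i l = a (shiftIdx n l (toℕ i))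

circulant-rows : ∀ {n} (a : Fin (suc n) → ℤ) (i i′ : Fin (suc n)) d →
  toℕ i′ ≡ toℕ i + d → circulant a i · circulant a i′ ≡ PAF (suc n) a d
circulant-rows {n} a i i′ d i′≡i+d = begin
  sumFin (suc n) (λ l → a (shift l (toℕ i)) ℤ.* a (shift l (toℕ i′)))
    ≡⟨ sumFin-cong (suc n) (λ l → cong (λ m → a (shift l (toℕ i)) ℤ.* a m) (shift-i′ l)) ⟩
  sumFin (suc n) (λ l → lagged (shift l (toℕ i)))
    ≡⟨ sumFin-rotate (toℕ i) lagged ⟩
  PAF (suc n) a d ∎
  where
  shift : Fin (suc n) → ℕ → Fin (suc n)
  shift = shiftIdx (suc n)
  lagged : Fin (suc n) → ℤ
  lagged m = a m ℤ.* a (shift m d)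
  shift-i′ : ∀ l → shift l (toℕ i′) ≡ shift (shift l (toℕ i)) d
  shift-i′ l = trans (cong (shift l) i′≡i+d) (sym (shiftIdx-+ l (toℕ i) d))

δ-refl : ∀ {k} (i : Fin k) → δ i i ≡ + 1
δ-refl zero    = refl
δ-refl (suc i) = δ-refl i

δ-≢ : ∀ {k} (i i′ : Fin k) → i ≢ i′ → δ i i′ ≡ + 0
δ-≢ zero    zero     i≢i′ with () ← i≢i′ refl
δ-≢ zero    (suc i′) i≢i′ = refl
δ-≢ (suc i) zero     i≢i′ = refl
δ-≢ (suc i) (suc i′) i≢i′ = δ-≢ i i′ (i≢i′ ∘ cong suc)

-- A ±1 matrix is partial Hadamard as soon as rows i < i′ are orthogonal:
-- the diagonal of the Gram matrix is automatic and it is symmetric.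
orthogonal⇒partialHadamard : ∀ {k m} (H : Fin k → Fin m → ℤ) →
  (∀ i j → IsPM1 (H i j)) → (∀ i i′ → toℕ i < toℕ i′ → H i · H i′ ≡ + 0) →
  IsPartialHadamard k m H
orthogonal⇒partialHadamard {m = m} H pm orthogonal = pm , gram
  where
  off-diagonal : ∀ i i′ → i ≢ i′ → H i · H i′ ≡ + 0 → H i · H i′ ≡ (+ m) ℤ.* δ i i′
  off-diagonal i i′ i≢i′ orth = trans orth (sym (trans (cong (λ x → (+ m) ℤ.* x) (δ-≢ i i′ i≢i′)) (ℤₚ.*-zeroʳ (+ m))))
  gram : ∀ i i′ → H i · H i′ ≡ (+ m) ℤ.* δ i i′
  gram i i′ with <-cmp (toℕ i) (toℕ i′)
  ... | tri< i<i′ i≢i′ _ = off-diagonal i i′ (i≢i′ ∘ cong toℕ) (orthogonal i i′ i<i′)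
  ... | tri> _ i≢i′ i>i′ =
    off-diagonal i i′ (i≢i′ ∘ cong toℕ) (trans (·-comm (H i) (H i′)) (orthogonal i′ i i>i′))
  ... | tri≈ _ i≡i′ _ with refl ← toℕ-injective i≡i′ = begin
    H i · H i        ≡⟨ ·-self-pm (H i) (pm i) ⟩
    + m              ≡⟨ sym (ℤₚ.*-identityʳ (+ m)) ⟩
    (+ m) ℤ.* + 1    ≡⟨ cong (λ x → (+ m) ℤ.* x) (sym (δ-refl i)) ⟩
    (+ m) ℤ.* δ i i ∎

pcomsMatrix : ∀ {n} .{{_ : NonZero n}} q c → (Fin q → Fin n → ℤ) → Fin n → Fin (q * n + c) → ℤ
pcomsMatrix q c A i = blocks q (λ t → circulant (A t) i) ++ (λ _ → + 1)

pcomsMatrix-partialHadamard : ∀ {n} q c (A : Fin q → Fin (suc n) → ℤ) →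
  IsPComS (suc n) q (- (+ c)) A → IsPartialHadamard (suc n) (q * suc n + c) (pcomsMatrix q c A)
pcomsMatrix-partialHadamard {n} q c A (binary , autocorrelations) =
  orthogonal⇒partialHadamard (pcomsMatrix q c A) entries orthogonal
  where
  ones : Fin c → ℤ
  ones _ = + 1
  ones-pm : ∀ j → IsPM1 (ones j)
  ones-pm _ = inj₁ refl
  entries : ∀ i j → IsPM1 (pcomsMatrix q c A i j)
  entries i = ++-all IsPM1 (blocks-all IsPM1 q (λ t l → binary t _)) ones-pm
  orthogonal : ∀ i i′ → toℕ i < toℕ i′ → pcomsMatrix q c A i · pcomsMatrix q c A i′ ≡ + 0
  orthogonal i i′ i<i′ = begin
    pcomsMatrix q c A i · pcomsMatrix q c A i′
      ≡⟨ ·-++ (blocks q (λ t → circulant (A t) i)) (blocks q (λ t → circulant (A t) i′)) ones ones ⟩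
    blocks q (λ t → circulant (A t) i) · blocks q (λ t → circulant (A t) i′) ℤ.+ ones · ones
      ≡⟨ cong₂ ℤ._+_ (·-blocks q _ _) (·-self-pm ones ones-pm) ⟩
    sumFin q (λ t → circulant (A t) i · circulant (A t) i′) ℤ.+ + c
      ≡⟨ cong (λ x → x ℤ.+ + c) (sumFin-cong q (λ t → circulant-rows (A t) i i′ d i′≡i+d)) ⟩
    sumFin q (λ t → PAF (suc n) (A t) d) ℤ.+ + c
      ≡⟨ cong (λ x → x ℤ.+ + c) (autocorrelations d (m<n⇒0<n∸m i<i′) d<n) ⟩
    - (+ c) ℤ.+ + c
      ≡⟨ ℤₚ.+-inverseˡ (+ c) ⟩
    + 0 ∎
    where
    d : ℕ
    d = toℕ i′ ∸ toℕ i
    i′≡i+d : toℕ i′ ≡ toℕ i + d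
    i′≡i+d = sym (m+[n∸m]≡n (<⇒≤ i<i′))
    d<n : d < suc n
    d<n = ≤-<-trans (m∸n≤m (toℕ i′) (toℕ i)) (toℕ<n i′)

theorem20 : (n q c : ℕ) → 1 ≤ n → 1 ≤ q → .{{_ : NonZero n}} →
    (∃[ A ] IsPComS n q (- (+ c)) A) →
    ∃[ H ] IsPartialHadamard n (n * q + c) H
theorem20 (suc n) q c _ _ (A , pcoms) =
  subst (λ m → ∃[ H ] IsPartialHadamard (suc n) m H) (cong (_+ c) (*-comm q (suc n)))
    (pcomsMatrix q c A , pcomsMatrix-partialHadamard q c A pcoms)
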